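{- Let $\omega$ be a finite sequence of output communications, let $\tau$ be $\omega$-pointed, and let $\tau\approx_\omega\tau'$. Then $\tau'$ is $\omega$-pointed and the last communication of $\tau'$ equals the last communication of $\tau$.
   Context: Participants $p,q,r,s$; labels $\ell$. A communication $\beta$ is $pq!\ell$ (output) or $pq?\ell$ (input), $\mathrm{play}(pq!\ell)=\{p\}$, $\mathrm{play}(pq?\ell)=\{q\}$, extended to traces by union. A trace is a finite sequence of communications; $\tau[i]$ is the $i$-th element, $\tau[i..j]$ the subtrace from $i$ to $j$ (empty if $i>j$), $|\tau|=n$ its length. $\#(pq\dagger,\tau)$ ($\dagger\in\{!,?\}$) counts elements of the form $pq\dagger\ell$. In $\tau$, the input $\tau[j]=pq?\ell$ matches the output $\tau[i]=pq!\ell$ if $i<j$ and $\#(pq!,\tau[1..i-1])=\#(pq?,\tau[1..j-1])$. $\tau$ is well formed if every input matches an output in it; $\tau$ is $\tau'$-well formed if $\tau'\cdot\tau$ is well formed. For $\omega$-well formed $\tau$, $\tau$ $\omega$-swaps to $\tau'$ if $\tau=\tau[1..i-1]\cdot\beta\cdot\beta'\cdot\tau''$, $\tau'=\tau[1..i-1]\cdot\beta'\cdot\beta\cdot\tau''$, $\mathrm{play}(\beta)\cap\mathrm{play}(\beta')=\emptyset$, and position $i+1+|\omega|$ of $\omega\cdot\tau$ does not match position $i+|\omega|$ of $\omega\cdot\tau$. $\approx_\omega$ is the reflexive and transitive closure of $\omega$-swapping on $\omega$-well-formed traces. $\tau[i]$ is required in $\tau$ if $\mathrm{play}(\tau[i])\subseteq\mathrm{play}(\tau[i+1..n])$.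 $\tau$ is $\tau'$-pointed if $\tau$ is $\tau'$-well formed and for every $i$ with $1\le i<n$, either $\tau[i]$ is required in $\tau$, or there is $j>i$ such that position $j+|\tau'|$ of $\tau'\cdot\tau$ matches position $i+|\tau'|$ of $\tau'\cdot\tau$. -}

module Defs where

open import Data.Nat using (ℕ; zero; suc; _+_; _<_)
open import Data.List using (List; []; _∷_; _++_; length; take; drop; last)
open import Data.List.Relation.Unary.All using (All)
open import Data.List.Relation.Unary.Any using (Any)
open import Data.Maybe using (Maybe; just; nothing)
open import Data.Product using (Σ; _×_; ∃; _,_)
open import Data.Sum using (_⊎_)
open import Relation.Binary.PropositionalEquality using (_≡_; _≢_)
open import Relation.Binary.Definitions using (DecidableEquality)
open import Relation.Nullary using (¬_; yes; no)

module Session {P L : Set} (_≟P_ : DecidableEquality P) where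

  -- pq!ℓ  is  out p q ℓ ,  pq?ℓ  is  inp p q ℓ
  data Comm : Set where
    out : P → P → L → Comm
    inp : P → P → L → Comm

  Trace : Set
  Trace = List Comm

  -- play(β) is a singleton; we return its unique element
  play : Comm → P
  play (out p _ _) = p
  play (inp _ q _) = q

  data IsOutput : Comm → Set where
    isOut : ∀ p q ℓ → IsOutput (out p q ℓ)

  -- 0-based lookup: τ !! i  corresponds to τ[i+1] of the paper
  _!!_ : Trace → ℕ → Maybe Comm
  []      !! _     = nothing
  (x ∷ _) !! zero  = just x
  (_ ∷ xs) !! suc i = xs !! i

  #out : P → P → Trace → ℕ
  #out p q [] = 0
  #out p q (out p' q' _ ∷ τ) with p ≟P p' | q ≟P q'
  ... | yes _ | yes _ = suc (#out p q τ)
  ... | _     | _     = #out p q τ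
  #out p q (inp _ _ _ ∷ τ) = #out p q τ

  #inp : P → P → Trace → ℕ
  #inp p q [] = 0
  #inp p q (inp p' q' _ ∷ τ) with p ≟P p' | q ≟P q'
  ... | yes _ | yes _ = suc (#inp p q τ)
  ... | _     | _     = #inp p q τ
  #inp p q (out _ _ _ ∷ τ) = #inp p q τ

  -- Matches τ j i : (0-based) position j of τ (an input) matches position i
  -- of τ (an output).  take i τ = τ[1..i-1] in 1-based terms.
  Matches : Trace → ℕ → ℕ → Set
  Matches τ j i =
    i < j × Σ P λ p → Σ P λ q → Σ L λ ℓ →
      (τ !! i ≡ just (out p q ℓ)) × (τ !! j ≡ just (inp p q ℓ)) ×
      (#out p q (take i τ) ≡ #inp p q (take j τ))

  WellFormed : Trace → Set
  WellFormed τ = ∀ j p q ℓ → τ !! j ≡ just (inp p q ℓ) → ∃ λ i → Matches τ j i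

  WellFormedAfter : Trace → Trace → Set
  WellFormedAfter ω τ = WellFormed (ω ++ τ)

  Swaps : Trace → Trace → Trace → Set
  Swaps ω τ τ' =
    Σ Trace λ a → Σ Comm λ β → Σ Comm λ β' → Σ Trace λ c →
      (τ ≡ a ++ β ∷ β' ∷ c) × (τ' ≡ a ++ β' ∷ β ∷ c) ×
      (play β ≢ play β') ×
      ¬ Matches (ω ++ τ) (suc (length ω + length a)) (length ω + length a)

  data Equiv (ω : Trace) : Trace → Trace → Set where
    ≈-refl : ∀ {τ} → WellFormedAfter ω τ → Equiv ω τ τ
    ≈-step : ∀ {τ τ' τ''} → WellFormedAfter ω τ → Swaps ω τ τ' →
             Equiv ω τ' τ'' → Equiv ω τ τ''

  Required : Trace → ℕ → Set
  Required τ i = Σ Comm λ β → (τ !! i ≡ just β) ×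
                   Any (λ β' → play β' ≡ play β) (drop (suc i) τ)

  Pointed : Trace → Trace → Set
  Pointed ω τ =
    WellFormedAfter ω τ ×
    (∀ i → suc i < length τ →
       Required τ i ⊎
       ∃ λ j → i < j × Matches (ω ++ τ) (length ω + j) (length ω + i))

-- It suffices to treat a single ω-swap of τ = a·β·β'·c into a·β'·β·c.  Exchanging
-- two adjacent positions n, n+1 of different players changes no per-channel count of
-- a prefix except the prefix ending between them, so every matching pair of τ other
-- than (n, n+1) is carried to a matching pair of the swapped trace, and being
-- required is preserved as well.  The excluded pair (n, n+1) is exactly what the
-- swap condition forbids.  Hence pointedness transfers position by position.  The
-- swapped pair cannot be the last two communications: β would then be neither
-- required (only β', of another player, follows) nor matched later (only β' could
-- match it).  So c is non-empty and the last communication is untouched.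
module Submission where

open import Defs
open import Data.List using (List; last; []; _∷_; _++_; length; take; drop)
open import Data.List.Relation.Unary.All using (All)
open import Data.List.Relation.Unary.Any using (Any; here; there)
open import Data.List.Relation.Binary.Permutation.Propositional using (_↭_; swap; ↭-refl)
open import Data.List.Relation.Binary.Permutation.Propositional.Properties
  using (Any-resp-↭; ↭-length; ++⁺ˡ)
open import Data.List.Properties using (++-assoc; length-++)
open import Data.Maybe using (just)
open import Data.Maybe.Properties using (just-injective)
open import Data.Nat using (ℕ; zero; suc; _+_; _<_; z≤n; s≤s; s≤s⁻¹)
open import Data.Nat.Properties
  using (≤-antisym; <-trans; n<1+n; +-suc; +-identityʳ; +-comm; +-assoc; +-cancelˡ-<)
open import Data.Product using (_×_; ∃; _,_; proj₁)
open import Data.Sum as Sum using (_⊎_; inj₁; inj₂)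
open import Data.Empty using (⊥-elim)
open import Function using (_∘_)
open import Relation.Nullary using (¬_; yes; no)
open import Relation.Binary.PropositionalEquality
open import Relation.Binary.Definitions using (DecidableEquality)

swapIndex : ℕ → ℕ → ℕ
swapIndex zero    zero          = 1
swapIndex zero    (suc zero)    = 0
swapIndex zero    (suc (suc i)) = suc (suc i)
swapIndex (suc m) zero          = zero
swapIndex (suc m) (suc i)       = suc (swapIndex m i)

swapIndex-involutive : ∀ m i → swapIndex m (swapIndex m i) ≡ i
swapIndex-involutive zero    zero          = refl
swapIndex-involutive zero    (suc zero)    = refl
swapIndex-involutive zero    (suc (suc i)) = refl
swapIndex-involutive (suc m) zero          = refl
swapIndex-involutive (suc m) (suc i)       = cong suc (swapIndex-involutive m i)

swapIndex-+ : ∀ k m i → swapIndex (k + m) (k + i) ≡ k + swapIndex m i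
swapIndex-+ zero    m i = refl
swapIndex-+ (suc k) m i = cong suc (swapIndex-+ k m i)

swapIndex-<-mono : ∀ m {i j} → i < j → ¬ (i ≡ m × j ≡ suc m) → swapIndex m i < swapIndex m j
swapIndex-<-mono zero    {zero}        {suc zero}    _         ¬pair = ⊥-elim (¬pair (refl , refl))
swapIndex-<-mono zero    {zero}        {suc (suc j)} _         _     = s≤s (s≤s z≤n)
swapIndex-<-mono zero    {suc zero}    {suc (suc j)} _         _     = s≤s z≤n
swapIndex-<-mono zero    {suc zero}    {suc zero}    (s≤s ())  _
swapIndex-<-mono zero    {suc (suc i)} {suc zero}    (s≤s ())  _
swapIndex-<-mono zero    {suc (suc i)} {suc (suc j)} i<j       _     = i<j
swapIndex-<-mono (suc m) {zero}        {suc j}       _         _     = s≤s z≤n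
swapIndex-<-mono (suc m) {suc i}       {suc j}       (s≤s i<j) ¬pair =
  s≤s (swapIndex-<-mono m i<j λ { (refl , refl) → ¬pair (refl , refl) })

swapIndex-suc-< : ∀ m i {n} → suc (suc m) < n → suc i < n → suc (swapIndex m i) < n
swapIndex-suc-< zero    zero          m+2<n _     = m+2<n
swapIndex-suc-< zero    (suc zero)    _     i+1<n = <-trans (n<1+n 1) i+1<n
swapIndex-suc-< zero    (suc (suc i)) _     i+1<n = i+1<n
swapIndex-suc-< (suc m) zero          _     i+1<n = i+1<n
swapIndex-suc-< (suc m) (suc i)       (s≤s m+2<n) (s≤s i+1<n) =
  s≤s (swapIndex-suc-< m i m+2<n i+1<n)

module AdditiveCount {A : Set} (f : List A → ℕ) (f-[] : f [] ≡ 0)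
                     (f-∷ : ∀ x xs → f (x ∷ xs) ≡ f (x ∷ []) + f xs) where

  f-∷-cong : ∀ z {xs ys} → f xs ≡ f ys → f (z ∷ xs) ≡ f (z ∷ ys)
  f-∷-cong z {xs} {ys} eq =
    trans (f-∷ z xs) (trans (cong (f (z ∷ []) +_) eq) (sym (f-∷ z ys)))

  f-swap : ∀ x y zs → f (x ∷ y ∷ zs) ≡ f (y ∷ x ∷ zs)
  f-swap x y zs = begin
    f (x ∷ y ∷ zs)             ≡⟨ f-∷ x (y ∷ zs) ⟩
    fx + f (y ∷ zs)            ≡⟨ cong (fx +_) (f-∷ y zs) ⟩
    fx + (fy + f zs)           ≡⟨ sym (+-assoc fx fy (f zs)) ⟩
    fx + fy + f zs             ≡⟨ cong (_+ f zs) (+-comm fx fy) ⟩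
    fy + fx + f zs             ≡⟨ +-assoc fy fx (f zs) ⟩
    fy + (fx + f zs)           ≡⟨ cong (fy +_) (sym (f-∷ x zs)) ⟩
    fy + f (x ∷ zs)            ≡⟨ sym (f-∷ y (x ∷ zs)) ⟩
    f (y ∷ x ∷ zs)             ∎
    where
    open ≡-Reasoning
    fx = f (x ∷ [])
    fy = f (y ∷ [])

  -- The two hypotheses cover the only prefixes that end inside the swapped pair.
  f-take-swap : ∀ as x y cs k →
    (k ≡ length as → f (y ∷ []) ≡ 0) → (k ≡ suc (length as) → f (x ∷ []) ≡ 0) →
    f (take (swapIndex (length as) k) (as ++ y ∷ x ∷ cs)) ≡ f (take k (as ++ x ∷ y ∷ cs))
  f-take-swap []       x y cs zero          fy≡0 _    = trans (fy≡0 refl) (sym f-[])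
  f-take-swap []       x y cs (suc zero)    _    fx≡0 = trans f-[] (sym (fx≡0 refl))
  f-take-swap []       x y cs (suc (suc k)) _    _    = f-swap y x (take k cs)
  f-take-swap (a ∷ as) x y cs zero          _    _    = refl
  f-take-swap (a ∷ as) x y cs (suc k)       fy≡0 fx≡0 =
    f-∷-cong a (f-take-swap as x y cs k (fy≡0 ∘ cong suc) (fx≡0 ∘ cong suc))

module _ {A : Set} where

  drop-++-suc-length : ∀ (as : List A) β cs → drop (suc (length as)) (as ++ β ∷ cs) ≡ cs
  drop-++-suc-length []       β cs = refl
  drop-++-suc-length (a ∷ as) β cs = drop-++-suc-length as β cs

  last-swap : ∀ (as : List A) β β' γ cs →
    last (as ++ β' ∷ β ∷ γ ∷ cs) ≡ last (as ++ β ∷ β' ∷ γ ∷ cs)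
  last-swap []            β β' γ cs = refl
  last-swap (a ∷ [])      β β' γ cs = refl
  last-swap (a ∷ a' ∷ as) β β' γ cs = last-swap (a' ∷ as) β β' γ cs

  ↭-swap-adjacent : ∀ (as : List A) β β' cs → as ++ β ∷ β' ∷ cs ↭ as ++ β' ∷ β ∷ cs
  ↭-swap-adjacent as β β' cs = ++⁺ˡ as (swap β β' ↭-refl)

module _ {P L : Set} (_≟P_ : DecidableEquality P) where
  open Session {P} {L} _≟P_

  !!-++-offset : ∀ as cs k → (as ++ cs) !! (k + length as) ≡ cs !! k
  !!-++-offset []       cs k rewrite +-identityʳ k    = refl
  !!-++-offset (a ∷ as) cs k rewrite +-suc k (length as) = !!-++-offset as cs k

  !!-just⇒< : ∀ cs k {γ} → cs !! k ≡ just γ → k < length cs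
  !!-just⇒< (c ∷ cs) zero    _  = s≤s z≤n
  !!-just⇒< (c ∷ cs) (suc k) eq = s≤s (!!-just⇒< cs k eq)

  !!-swap : ∀ as β β' cs k →
    (as ++ β' ∷ β ∷ cs) !! swapIndex (length as) k ≡ (as ++ β ∷ β' ∷ cs) !! k
  !!-swap []       β β' cs zero          = refl
  !!-swap []       β β' cs (suc zero)    = refl
  !!-swap []       β β' cs (suc (suc k)) = refl
  !!-swap (a ∷ as) β β' cs zero          = refl
  !!-swap (a ∷ as) β β' cs (suc k)       = !!-swap as β β' cs k

  Required-swap : ∀ as β β' cs i → play β ≢ play β' → Required (as ++ β ∷ β' ∷ cs) i →
    Required (as ++ β' ∷ β ∷ cs) (swapIndex (length as) i)
  Required-swap []       β β' cs zero          ne (γ , refl , here eq) = ⊥-elim (ne (sym eq))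
  Required-swap []       β β' cs zero          ne (γ , eq , there any) = γ , eq , any
  Required-swap []       β β' cs (suc zero)    ne (γ , eq , any)       = γ , eq , there any
  Required-swap []       β β' cs (suc (suc i)) ne req                  = req
  Required-swap (a ∷ as) β β' cs zero          ne (γ , eq , any)       =
    γ , eq , Any-resp-↭ (↭-swap-adjacent as β β' cs) any
  Required-swap (a ∷ as) β β' cs (suc i)       ne req                  =
    Required-swap as β β' cs i ne req

  #out-∷ : ∀ p q x xs → #out p q (x ∷ xs) ≡ #out p q (x ∷ []) + #out p q xs
  #out-∷ p q (out p' q' ℓ) xs with p ≟P p' | q ≟P q'
  ... | yes _ | yes _ = refl
  ... | yes _ | no _  = refl
  ... | no _  | _     = refl
  #out-∷ p q (inp _ _ _)   xs = refl

  #inp-∷ : ∀ p q x xs → #inp p q (x ∷ xs) ≡ #inp p q (x ∷ []) + #inp p q xs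
  #inp-∷ p q (inp p' q' ℓ) xs with p ≟P p' | q ≟P q'
  ... | yes _ | yes _ = refl
  ... | yes _ | no _  = refl
  ... | no _  | _     = refl
  #inp-∷ p q (out _ _ _)   xs = refl

  #out-other : ∀ p q x → play x ≢ p → #out p q (x ∷ []) ≡ 0
  #out-other p q (out p' q' ℓ) ne with p ≟P p' | q ≟P q'
  ... | yes refl | yes _ = ⊥-elim (ne refl)
  ... | yes _    | no _  = refl
  ... | no _     | _     = refl
  #out-other p q (inp _ _ _)   ne = refl

  #inp-other : ∀ p q x → play x ≢ q → #inp p q (x ∷ []) ≡ 0
  #inp-other p q (inp p' q' ℓ) ne with p ≟P p' | q ≟P q'
  ... | yes _ | yes refl = ⊥-elim (ne refl)
  ... | yes _ | no _     = refl
  ... | no _  | _        = refl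
  #inp-other p q (out _ _ _)   ne = refl

  module #Out (p q : P) = AdditiveCount (#out p q) refl (#out-∷ p q)
  module #Inp (p q : P) = AdditiveCount (#inp p q) refl (#inp-∷ p q)

  Matches-swap : ∀ as β β' cs {j i} → play β ≢ play β' →
    ¬ Matches (as ++ β ∷ β' ∷ cs) (suc (length as)) (length as) →
    Matches (as ++ β ∷ β' ∷ cs) j i →
    Matches (as ++ β' ∷ β ∷ cs) (swapIndex (length as) j) (swapIndex (length as) i)
  Matches-swap as β β' cs {j} {i} ne ¬m m@(i<j , p , q , ℓ , at-i , at-j , counts) =
    swapIndex-<-mono (length as) i<j (λ { (refl , refl) → ¬m m }) ,
    p , q , ℓ ,
    trans (!!-swap as β β' cs i) at-i ,
    trans (!!-swap as β β' cs j) at-j ,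
    (begin
      #out p q (take (swapIndex (length as) i) (as ++ β' ∷ β ∷ cs))
        ≡⟨ #Out.f-take-swap p q as β β' cs i
             (λ e → #out-other p q β' λ e' → at-β e at-i (sym e'))
             (λ e → #out-other p q β λ e' → at-β' e at-i (sym e')) ⟩
      #out p q (take i (as ++ β ∷ β' ∷ cs))
        ≡⟨ counts ⟩
      #inp p q (take j (as ++ β ∷ β' ∷ cs))
        ≡⟨ sym (#Inp.f-take-swap p q as β β' cs j
             (λ e → #inp-other p q β' λ e' → at-β e at-j (sym e'))
             (λ e → #inp-other p q β λ e' → at-β' e at-j (sym e'))) ⟩
      #inp p q (take (swapIndex (length as) j) (as ++ β' ∷ β ∷ cs)) ∎)
    where
    open ≡-Reasoning
    X = as ++ β ∷ β' ∷ cs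
    at-β : ∀ {k γ} → k ≡ length as → X !! k ≡ just γ → play γ ≢ play β'
    at-β refl eq = subst (λ γ → play γ ≢ play β')
      (just-injective (trans (sym (!!-++-offset as (β ∷ β' ∷ cs) 0)) eq)) ne
    at-β' : ∀ {k γ} → k ≡ suc (length as) → X !! k ≡ just γ → play γ ≢ play β
    at-β' refl eq = subst (λ γ → play γ ≢ play β)
      (just-injective (trans (sym (!!-++-offset as (β ∷ β' ∷ cs) 1)) eq)) (ne ∘ sym)

  Matches-swap-after : ∀ ω as β β' cs {j i} → play β ≢ play β' →
    ¬ Matches (ω ++ as ++ β ∷ β' ∷ cs) (suc (length ω + length as)) (length ω + length as) →
    Matches (ω ++ as ++ β ∷ β' ∷ cs) (length ω + j) (length ω + i) →
    Matches (ω ++ as ++ β' ∷ β ∷ cs)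
      (length ω + swapIndex (length as) j) (length ω + swapIndex (length as) i)
  Matches-swap-after ω as β β' cs {j} {i} ne ¬m m
    rewrite sym (swapIndex-+ (length ω) (length as) j)
          | sym (swapIndex-+ (length ω) (length as) i)
          | sym (length-++ ω {as})
          | sym (++-assoc ω as (β ∷ β' ∷ cs))
          | sym (++-assoc ω as (β' ∷ β ∷ cs))
    = Matches-swap (ω ++ as) β β' cs ne ¬m m

  !!-just-after-penultimate : ∀ ω as β β' {j δ} → length as < j →
    (ω ++ as ++ β ∷ β' ∷ []) !! (length ω + j) ≡ just δ →
    length ω + j ≡ suc (length ω + length as)
  !!-just-after-penultimate ω as β β' {j} {δ} n<j at-j = begin
    length ω + j               ≡⟨ cong (length ω +_) (≤-antisym (s≤s⁻¹ j<n+2) n<j) ⟩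
    length ω + suc (length as) ≡⟨ +-suc (length ω) (length as) ⟩
    suc (length ω + length as) ∎
    where
    open ≡-Reasoning
    τ = as ++ β ∷ β' ∷ []
    j<n+2 : j < suc (suc (length as))
    j<n+2 = subst (j <_) (trans (length-++ as) (+-comm (length as) 2))
      (!!-just⇒< τ j (trans (sym (!!-++-offset ω τ j))
        (subst (λ k → (ω ++ τ) !! k ≡ just δ) (+-comm (length ω) j) at-j)))

  PointedPositions : Trace → Trace → Set
  PointedPositions ω τ = ∀ i → suc i < length τ →
    Required τ i ⊎ ∃ λ j → i < j × Matches (ω ++ τ) (length ω + j) (length ω + i)

  swap-not-at-end : ∀ ω as β β' → play β ≢ play β' →
    ¬ Matches (ω ++ as ++ β ∷ β' ∷ []) (suc (length ω + length as)) (length ω + length as) →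
    ¬ PointedPositions ω (as ++ β ∷ β' ∷ [])
  swap-not-at-end ω as β β' ne ¬m pointed
    with pointed (length as)
           (!!-just⇒< (as ++ β ∷ β' ∷ []) (suc (length as)) (!!-++-offset as (β ∷ β' ∷ []) 1))
  ... | inj₁ (γ , at , later) =
    β-unrequired (just-injective (trans (sym (!!-++-offset as (β ∷ β' ∷ []) 0)) at))
                 (subst (Any _) (drop-++-suc-length as β (β' ∷ [])) later)
    where
    β-unrequired : ∀ {γ} → β ≡ γ → ¬ Any (λ x → play x ≡ play γ) (β' ∷ [])
    β-unrequired refl (here eq) = ne (sym eq)
  ... | inj₂ (j , n<j , m@(_ , _ , _ , _ , _ , at-j , _)) =
    ¬m (subst (λ k → Matches (ω ++ as ++ β ∷ β' ∷ []) k (length ω + length as))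
              (!!-just-after-penultimate ω as β β' n<j at-j) m)

  PointedPositions-swap : ∀ ω as β β' γ cs → play β ≢ play β' →
    ¬ Matches (ω ++ as ++ β ∷ β' ∷ γ ∷ cs) (suc (length ω + length as)) (length ω + length as) →
    PointedPositions ω (as ++ β ∷ β' ∷ γ ∷ cs) → PointedPositions ω (as ++ β' ∷ β ∷ γ ∷ cs)
  PointedPositions-swap ω as β β' γ cs ne ¬m pointed i i+1<n =
    Sum.map required matched (pointed (swapIndex n i) bound)
    where
    n = length as
    τ  = as ++ β ∷ β' ∷ γ ∷ cs
    τ' = as ++ β' ∷ β ∷ γ ∷ cs
    bound : suc (swapIndex n i) < length τ
    bound = swapIndex-suc-< n i
              (!!-just⇒< τ (suc (suc n)) (!!-++-offset as (β ∷ β' ∷ γ ∷ cs) 2))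
              (subst (suc i <_) (sym (↭-length (↭-swap-adjacent as β β' (γ ∷ cs)))) i+1<n)
    required : Required τ (swapIndex n i) → Required τ' i
    required req =
      subst (Required τ') (swapIndex-involutive n i) (Required-swap as β β' (γ ∷ cs) _ ne req)
    matched : ∃ (λ j → swapIndex n i < j ×
                        Matches (ω ++ τ) (length ω + j) (length ω + swapIndex n i)) →
              ∃ (λ j → i < j × Matches (ω ++ τ') (length ω + j) (length ω + i))
    matched (j , _ , m) = swapIndex n j , +-cancelˡ-< (length ω) i _ (proj₁ m') , m'
      where
      m' : Matches (ω ++ τ') (length ω + swapIndex n j) (length ω + i)
      m' = subst (λ k → Matches (ω ++ τ') (length ω + swapIndex n j) (length ω + k))
             (swapIndex-involutive n i) (Matches-swap-after ω as β β' (γ ∷ cs) ne ¬m m)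

  Pointed-swap : ∀ {ω τ τ'} → Pointed ω τ → Swaps ω τ τ' →
    PointedPositions ω τ' × last τ' ≡ last τ
  Pointed-swap {ω} (_ , pointed) (as , β , β' , [] , refl , refl , ne , ¬m) =
    ⊥-elim (swap-not-at-end ω as β β' ne ¬m pointed)
  Pointed-swap {ω} (_ , pointed) (as , β , β' , γ ∷ cs , refl , refl , ne , ¬m) =
    PointedPositions-swap ω as β β' γ cs ne ¬m pointed , last-swap as β β' γ cs

  Equiv-source-wellFormed : ∀ {ω τ τ'} → Equiv ω τ τ' → WellFormedAfter ω τ
  Equiv-source-wellFormed (≈-refl wf)     = wf
  Equiv-source-wellFormed (≈-step wf _ _) = wf

  Pointed-≈ : ∀ {ω τ τ'} → Pointed ω τ → Equiv ω τ τ' → Pointed ω τ' × last τ' ≡ last τ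
  Pointed-≈ pointed (≈-refl _)           = pointed , refl
  Pointed-≈ pointed (≈-step _ swaps rest) =
    let positions , last-swapped = Pointed-swap pointed swaps
        pointed′ , last-rest     = Pointed-≈ (Equiv-source-wellFormed rest , positions) rest
    in  pointed′ , trans last-rest last-swapped

lemma7p10 : {P L : Set} (_≟P_ : DecidableEquality P) →
    let open Session {P} {L} _≟P_ in
    (ω τ τ' : Trace) → All IsOutput ω → Pointed ω τ → Equiv ω τ τ' →
    Pointed ω τ' × last τ' ≡ last τ
-- The argument never needs ω to consist of outputs.
lemma7p10 _≟P_ _ _ _ _ = Pointed-≈ _≟P_
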